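{- For all integers $q,s\ge 1$ and every $\mathbf{t}\in\mathbb{N}_+^q$ there exists an $n$-vertex $s$-connector $G$ with $n=\|\mathbf{t}\|_\infty+\Lambda_\mathbf{t}+s-1$ such that $G\not\to\mathbf{t} K_2$.
   Context: $\mathbb{N}_+$ denotes the positive integers and $[q]=\{1,\dots,q\}$. A graph $G=(V,E)$ is an $s$-connector if $E$ contains an edge between $X$ and $Y$ for every pair of disjoint sets $X,Y\subseteq V$ with $|X|,|Y|\ge s$. For $\mathbf{t}=(t_1,\dots,t_q)\in\mathbb{N}_+^q$, $\|\mathbf{t}\|_\infty=\max_j t_j$ and $\Lambda_\mathbf{t}=\sum_{i=1}^q(t_i-1)$. We write $G\to\mathbf{t}K_2$ if every $q$-edge-colouring of $G$ contains, for some $j\in[q]$, a matching of size $t_j$ all of whose edges have colour $j$; $G\not\to\mathbf{t}K_2$ means this fails. -}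

module Defs where

open import Data.Nat using (ℕ; zero; suc; _+_; _∸_; _⊔_; _≤_; _<_)
open import Data.Fin using (Fin)
open import Data.Fin.Subset using (Subset; _∈_; ∣_∣)
open import Data.Vec.Functional using (foldr)
open import Data.Bool using (Bool; true)
open import Data.Sum using (_⊎_; inj₁; inj₂; [_,_])
open import Data.Product using (_×_; ∃-syntax)
open import Relation.Binary.PropositionalEquality using (_≡_)
open import Relation.Nullary using (¬_)
open import Function.Definitions using (Injective)

record Graph (n : ℕ) : Set where
  field
    adj  : Fin n → Fin n → Bool
    sym  : ∀ u v → adj u v ≡ adj v u
    irr  : ∀ u → ¬ (adj u u ≡ true)
open Graph public

Edge : ∀ {n} → Graph n → Fin n → Fin n → Set
Edge G u v = adj G u v ≡ true

Disjoint : ∀ {n} → Subset n → Subset n → Set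
Disjoint {n} X Y = ∀ (v : Fin n) → v ∈ X → ¬ (v ∈ Y)

IsConnector : ∀ {n} → ℕ → Graph n → Set
IsConnector {n} s G =
  ∀ (X Y : Subset n) → Disjoint X Y → s ≤ ∣ X ∣ → s ≤ ∣ Y ∣ →
  ∃[ x ] ∃[ y ] (x ∈ X × y ∈ Y × Edge G x y)

record Colouring {n : ℕ} (q : ℕ) (G : Graph n) : Set where
  field
    col     : ∀ u v → Edge G u v → Fin q
    col-sym : ∀ u v (e : Edge G u v) (e' : Edge G v u) → col u v e ≡ col v u e'
open Colouring public

-- A matching of size k all of whose edges have colour j: edges {a i, b i}
-- for i : Fin k, the 2k endpoints pairwise distinct.
record MonoMatching {n q : ℕ} {G : Graph n} (c : Colouring q G) (j : Fin q) (k : ℕ) : Set where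
  field
    a b    : Fin k → Fin n
    edge   : ∀ i → Edge G (a i) (b i)
    colour : ∀ i → col c (a i) (b i) (edge i) ≡ j
    inj    : Injective _≡_ _≡_ [ a , b ]

Arrows : ∀ {n q} → Graph n → (Fin q → ℕ) → Set
Arrows {n} {q} G t = ∀ (c : Colouring q G) → ∃[ j ] MonoMatching c j (t j)

-- ‖t‖∞ (0 for q = 0) and Λ_t = Σ (t_i − 1)
maxNorm : ∀ {q} → (Fin q → ℕ) → ℕ
maxNorm t = foldr _⊔_ 0 t

Lambda : ∀ {q} → (Fin q → ℕ) → ℕ
Lambda t = foldr (λ x acc → (x ∸ 1) + acc) 0 t

{-# OPTIONS --safe #-}
module Submission where

open import Defs hiding (sym)
open import Data.Nat using (ℕ; zero; suc; _+_; _∸_; _⊓_; _≤_; _<_; z≤n; s≤s; _<?_)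
open import Data.Nat.Properties hiding (_≟_)
open import Data.Fin using (Fin; zero; suc; toℕ; fromℕ<; splitAt; join; _≟_)
open import Data.Fin.Properties using (¬Fin0; toℕ-fromℕ<; toℕ-injective; injective⇒≤; join-splitAt)
open import Data.Fin.Subset using (Subset; _∈_; ∣_∣)
open import Data.Fin.Subset.Properties using (∣p∣≤n)
open import Data.Vec using ([]; _∷_; here; there)
open import Data.Vec.Functional using (Vector; foldr; map; updateAt; tail)
open import Data.Vec.Functional.Properties using (updateAt-updates; updateAt-minimal)
open import Data.Bool using (true; false)
open import Data.Sum using (_⊎_; inj₁; inj₂; [_,_]′; reduce)
open import Data.Product using (Σ; ∃-syntax; _×_; _,_; proj₁; proj₂)
open import Data.Empty using (⊥-elim)
open import Function using (_∘_; const; mk⇔)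
open import Function.Definitions using (Injective)
open import Relation.Nullary using (¬_; Dec; does; proof; yes; no)
open import Relation.Nullary.Reflects using (Reflects; invert)
open import Relation.Nullary.Decidable using (_×-dec_; ¬?; does-⇔; dec-true)
open import Relation.Binary.PropositionalEquality hiding ([_])

-- Take a clique on the first N = ‖t‖∞ + Λ vertices and leave the other s − 1
-- isolated, so every s-set meets the clique.  Colour an edge by the colour of
-- its lower endpoint, where positions are cut into consecutive blocks of
-- length t_i − 1 for every colour i except one colour d with t_d maximal, and
-- colour d takes the remaining ‖t‖∞ + t_d − 1 positions.  The lower endpoints
-- of a colour-i matching are distinct points of block i, so it has fewer than
-- t_i edges; the 2 t_d endpoints of a colour-d matching would all lie among
-- the last ‖t‖∞ + t_d − 1 ≤ 2 t_d − 1 positions.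

injective-in-interval⇒≤ : ∀ {m} L U (f : Fin m → ℕ) → Injective _≡_ _≡_ f →
  (∀ i → L ≤ f i) → (∀ i → f i < U) → m ≤ U ∸ L
injective-in-interval⇒≤ L U f f-inj L≤f f<U = injective⇒≤ shifted-injective
  where
  shifted : ∀ i → f i ∸ L < U ∸ L
  shifted i = ∸-monoˡ-< (f<U i) (L≤f i)

  shifted-injective : Injective _≡_ _≡_ (λ i → fromℕ< (shifted i))
  shifted-injective {i} {j} eq = f-inj (∸-cancelʳ-≡ (L≤f i) (L≤f j) (begin
    f i ∸ L                ≡⟨ toℕ-fromℕ< (shifted i) ⟨
    toℕ (fromℕ< (shifted i)) ≡⟨ cong toℕ eq ⟩
    toℕ (fromℕ< (shifted j)) ≡⟨ toℕ-fromℕ< (shifted j) ⟩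
    f j ∸ L                ∎))
    where open ≡-Reasoning

⊓-side : ∀ {A : Set} (f : A ⊎ A → ℕ) x →
  ∃[ e ] (reduce e ≡ x × f (inj₁ x) ⊓ f (inj₂ x) ≡ f e)
⊓-side f x with ⊓-sel (f (inj₁ x)) (f (inj₂ x))
... | inj₁ eq = inj₁ x , refl , eq
... | inj₂ eq = inj₂ x , refl , eq

⊓-injective : ∀ {A : Set} {f : A ⊎ A → ℕ} → Injective _≡_ _≡_ f →
  Injective _≡_ _≡_ (λ x → f (inj₁ x) ⊓ f (inj₂ x))
⊓-injective {f = f} f-inj {x} {y} eq with ⊓-side f x | ⊓-side f y
... | e , refl , fx≡fe | e′ , refl , fy≡fe′ =
  cong reduce (f-inj (trans (sym fx≡fe) (trans eq fy≡fe′)))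

sum : ∀ {q} → Vector ℕ q → ℕ
sum = foldr _+_ 0

sum-updateAt-0 : ∀ {q} (xs : Vector ℕ q) i → sum (updateAt xs i (const 0)) + xs i ≡ sum xs
sum-updateAt-0 xs zero    = +-comm (sum (tail xs)) (xs zero)
sum-updateAt-0 xs (suc i) =
  trans (+-assoc (xs zero) _ _) (cong (xs zero +_) (sum-updateAt-0 (tail xs) i))

Lambda≡sum : ∀ {q} (t : Vector ℕ q) → Lambda t ≡ sum (map (_∸ 1) t)
Lambda≡sum {zero}  t = refl
Lambda≡sum {suc q} t = cong (t zero ∸ 1 +_) (Lambda≡sum (tail t))

maxNorm≤entry : ∀ {q} (t : Vector ℕ (suc q)) → ∃[ j ] maxNorm t ≤ t j
maxNorm≤entry {zero} t = zero , ≤-reflexive (⊔-identityʳ (t zero))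
maxNorm≤entry {suc q} t with ⊔-sel (t zero) (maxNorm (tail t))
... | inj₁ eq = zero , ≤-reflexive eq
... | inj₂ eq = let j , le = maxNorm≤entry (tail t) in suc j , ≤-trans (≤-reflexive eq) le

k≰k∸1 : ∀ {k} → 1 ≤ k → ¬ (k ≤ k ∸ 1)
k≰k∸1 {suc k} _ = n≮n k

position : ∀ {q} (sz : Vector ℕ q) → Σ (Fin q) (Fin ∘ sz) → ℕ
position sz (zero  , x) = toℕ x
position sz (suc i , x) = sz zero + position (tail sz) (i , x)

locate : ∀ {q} (sz : Vector ℕ q) p → (∃[ v ] position sz v ≡ p) ⊎ sum sz ≤ p
locate {zero}  sz p = inj₂ z≤n
locate {suc q} sz p with p <? sz zero
... | yes p<sz₀ = inj₁ ((zero , fromℕ< p<sz₀) , toℕ-fromℕ< p<sz₀)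
... | no p≮sz₀ with locate (tail sz) (p ∸ sz zero)
...   | inj₁ ((i , x) , eq) =
        inj₁ ((suc i , x) , trans (cong (sz zero +_) eq) (m+[n∸m]≡n (≮⇒≥ p≮sz₀)))
...   | inj₂ le = inj₂ (≤-trans (+-monoʳ-≤ (sz zero) le) (≤-reflexive (m+[n∸m]≡n (≮⇒≥ p≮sz₀))))

blockColour : ∀ {q} → Vector ℕ q → Fin q → ℕ → Fin q
blockColour sz d p with locate sz p
... | inj₁ ((i , _) , _) = i
... | inj₂ _             = d

blockColour-offset : ∀ {q} (sz : Vector ℕ q) {d j} p → j ≢ d → blockColour sz d p ≡ j →
  ∃[ x ] position sz (j , x) ≡ p
blockColour-offset sz p j≢d eq with locate sz p
blockColour-offset sz p j≢d refl | inj₁ ((_ , x) , pos≡p) = x , pos≡p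
blockColour-offset sz p j≢d refl | inj₂ _ = ⊥-elim (j≢d refl)

blockColour-default : ∀ {q} (sz : Vector ℕ q) {d} p → sz d ≡ 0 → blockColour sz d p ≡ d → sum sz ≤ p
blockColour-default sz p sz-d≡0 eq with locate sz p
blockColour-default sz p sz-d≡0 refl | inj₁ ((_ , x) , _) = ⊥-elim (¬Fin0 (subst Fin sz-d≡0 x))
blockColour-default sz p sz-d≡0 refl | inj₂ le = le

LowPair : ∀ {n} → ℕ → Fin n → Fin n → Set
LowPair N u v = toℕ u < N × toℕ v < N × u ≢ v

lowPair? : ∀ {n} N (u v : Fin n) → Dec (LowPair N u v)
lowPair? N u v = toℕ u <? N ×-dec toℕ v <? N ×-dec ¬? (u ≟ v)

lowPair-sym : ∀ {n N} {u v : Fin n} → LowPair N u v → LowPair N v u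
lowPair-sym (u<N , v<N , u≢v) = v<N , u<N , u≢v ∘ sym

toLowPair : ∀ {n N} {u v : Fin n} → does (lowPair? N u v) ≡ true → LowPair N u v
toLowPair {N = N} {u} {v} e = invert (subst (Reflects _) e (proof (lowPair? N u v)))

clique : ∀ {n} → ℕ → Graph n
clique N = record
  { adj = λ u v → does (lowPair? N u v)
  ; sym = λ u v → does-⇔ (mk⇔ lowPair-sym lowPair-sym) (lowPair? N u v) (lowPair? N v u)
  ; irr = λ u e → proj₂ (proj₂ (toLowPair {N = N} e)) refl
  }

low-vertex : ∀ {n} N (X : Subset n) → n ∸ N < ∣ X ∣ → ∃[ x ] (x ∈ X × toℕ x < N)
low-vertex zero X n<∣X∣ = ⊥-elim (<⇒≱ n<∣X∣ (∣p∣≤n X))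
low-vertex {zero}  (suc N) [] ()
low-vertex {suc n} (suc N) (true  ∷ X) _ = zero , here , s≤s z≤n
low-vertex {suc n} (suc N) (false ∷ X) h =
  let x , x∈X , x<N = low-vertex N X h in suc x , there x∈X , s≤s x<N

clique-isConnector : ∀ {n s} N → n ∸ N < s → IsConnector s (clique {n} N)
clique-isConnector N n∸N<s X Y X∩Y≡∅ s≤∣X∣ s≤∣Y∣ =
  let x , x∈X , x<N = low-vertex N X (<-≤-trans n∸N<s s≤∣X∣)
      y , y∈Y , y<N = low-vertex N Y (<-≤-trans n∸N<s s≤∣Y∣)
  in x , y , x∈X , y∈Y ,
     dec-true (lowPair? N x y) (x<N , y<N , λ x≡y → X∩Y≡∅ x x∈X (subst (_∈ Y) (sym x≡y) y∈Y))

minColouring : ∀ {n q} (G : Graph n) → (ℕ → Fin q) → Colouring q G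
minColouring G π = record
  { col     = λ u v _ → π (toℕ u ⊓ toℕ v)
  ; col-sym = λ u v _ _ → cong π (⊓-comm (toℕ u) (toℕ v))
  }

module _ {n q k : ℕ} {G : Graph n} {c : Colouring q G} {j : Fin q} (mm : MonoMatching c j k) where
  open MonoMatching mm

  endpoint : Fin k ⊎ Fin k → ℕ
  endpoint e = toℕ ([ a , b ]′ e)

  endpoint-injective : Injective _≡_ _≡_ endpoint
  endpoint-injective {x} {y} eq = inj {x} {y} (toℕ-injective eq)

  lowerEndpoint-injective : Injective _≡_ _≡_ (λ i → toℕ (a i) ⊓ toℕ (b i))
  lowerEndpoint-injective = ⊓-injective {f = endpoint} endpoint-injective

  matching-in-interval⇒≤ : ∀ L U → (∀ e → L ≤ endpoint e) → (∀ e → endpoint e < U) → k + k ≤ U ∸ L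
  matching-in-interval⇒≤ L U L≤ <U =
    injective-in-interval⇒≤ L U (endpoint ∘ splitAt k) splitAt-endpoint-injective
      (L≤ ∘ splitAt k) (<U ∘ splitAt k)
    where
    splitAt-endpoint-injective : Injective _≡_ _≡_ (endpoint ∘ splitAt k)
    splitAt-endpoint-injective {r} {r′} eq =
      trans (sym (join-splitAt k k r))
        (trans (cong (join k k) (endpoint-injective {splitAt k r} {splitAt k r′} eq)) (join-splitAt k k r′))

clique-endpoint< : ∀ {n q k N} {c : Colouring q (clique {n} N)} {j} (mm : MonoMatching c j k) →
  ∀ e → endpoint mm e < N
clique-endpoint< {N = N} mm (inj₁ i) = proj₁ (toLowPair {N = N} (MonoMatching.edge mm i))
clique-endpoint< {N = N} mm (inj₂ i) = proj₁ (proj₂ (toLowPair {N = N} (MonoMatching.edge mm i)))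

module _ {n q : ℕ} (G : Graph n) (sz : Vector ℕ q) (d : Fin q) where

  blockMatching-≤ : ∀ {j k} → j ≢ d → MonoMatching (minColouring G (blockColour sz d)) j k → k ≤ sz j
  blockMatching-≤ {j} {k} j≢d mm = injective⇒≤ offset-injective
    where
    open MonoMatching mm
    located : ∀ i → ∃[ x ] position sz (j , x) ≡ toℕ (a i) ⊓ toℕ (b i)
    located i = blockColour-offset sz _ j≢d (colour i)

    offset-injective : Injective _≡_ _≡_ (proj₁ ∘ located)
    offset-injective {i} {i′} eq = lowerEndpoint-injective mm
      (trans (sym (proj₂ (located i))) (trans (cong (λ x → position sz (j , x)) eq) (proj₂ (located i′))))

  blockMatching-above : ∀ {k} → sz d ≡ 0 → (mm : MonoMatching (minColouring G (blockColour sz d)) d k) →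
    ∀ e → sum sz ≤ endpoint mm e
  blockMatching-above sz-d≡0 mm (inj₁ i) =
    ≤-trans (blockColour-default sz _ sz-d≡0 (MonoMatching.colour mm i)) (m⊓n≤m _ _)
  blockMatching-above sz-d≡0 mm (inj₂ i) =
    ≤-trans (blockColour-default sz _ sz-d≡0 (MonoMatching.colour mm i)) (m⊓n≤n _ _)

module _ {q : ℕ} (t : Vector ℕ q) (d : Fin q) where

  sizes : Vector ℕ q
  sizes = updateAt (map (_∸ 1) t) d (const 0)

  clique-room-above-blocks : (maxNorm t + Lambda t) ∸ sum sizes ≡ maxNorm t + (t d ∸ 1)
  clique-room-above-blocks = begin
    (M + Lambda t) ∸ S             ≡⟨ cong (λ l → (M + l) ∸ S) Lambda-split ⟩
    (M + (S + (t d ∸ 1))) ∸ S      ≡⟨ +-∸-assoc M (m≤m+n S (t d ∸ 1)) ⟩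
    M + ((S + (t d ∸ 1)) ∸ S)      ≡⟨ cong (M +_) (m+n∸m≡n S (t d ∸ 1)) ⟩
    M + (t d ∸ 1)                  ∎
    where
    open ≡-Reasoning
    M S : ℕ
    M = maxNorm t
    S = sum sizes
    Lambda-split : Lambda t ≡ S + (t d ∸ 1)
    Lambda-split = trans (Lambda≡sum t) (sym (sum-updateAt-0 (map (_∸ 1) t) d))

  module _ {n : ℕ} where
    extremalGraph : Graph n
    extremalGraph = clique (maxNorm t + Lambda t)

    extremalColouring : Colouring q extremalGraph
    extremalColouring = minColouring extremalGraph (blockColour sizes d)

    matching-bound : maxNorm t ≤ t d → ∀ {j} → MonoMatching extremalColouring j (t j) → t j ≤ t j ∸ 1
    matching-bound t-max {j} mm with j ≟ d
    ... | no j≢d = subst (t j ≤_) (updateAt-minimal j d (map (_∸ 1) t) j≢d)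
                     (blockMatching-≤ extremalGraph sizes d j≢d mm)
    ... | yes refl = +-cancelˡ-≤ (t d) _ _ (begin
      t d + t d                          ≤⟨ matching-in-interval⇒≤ mm _ _ above below ⟩
      (maxNorm t + Lambda t) ∸ sum sizes ≡⟨ clique-room-above-blocks ⟩
      maxNorm t + (t d ∸ 1)              ≤⟨ +-monoˡ-≤ (t d ∸ 1) t-max ⟩
      t d + (t d ∸ 1)                    ∎)
      where
      open ≤-Reasoning
      above : ∀ e → sum sizes ≤ endpoint mm e
      above = blockMatching-above extremalGraph sizes d (updateAt-updates d (map (_∸ 1) t)) mm

      below : ∀ e → endpoint mm e < maxNorm t + Lambda t
      below = clique-endpoint< mm

    not-arrows : maxNorm t ≤ t d → (∀ i → 1 ≤ t i) → ¬ Arrows extremalGraph t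
    not-arrows t-max t-pos arrows =
      let j , mm = arrows extremalColouring in k≰k∸1 (t-pos j) (matching-bound t-max mm)

proposition1p2 : ∀ (q s : ℕ) → 1 ≤ q → 1 ≤ s → (t : Fin q → ℕ) → (∀ i → 1 ≤ t i) →
    ∃[ G ] (IsConnector s G × ¬ Arrows {maxNorm t + Lambda t + s ∸ 1} G t)
proposition1p2 (suc q) (suc s) _ _ t t-pos =
  let d , t-max = maxNorm≤entry t in
  extremalGraph t d , clique-isConnector N isolated<s , not-arrows t d t-max t-pos
  where
  N : ℕ
  N = maxNorm t + Lambda t
  isolated<s : N + suc s ∸ 1 ∸ N < suc s
  isolated<s = s≤s (≤-reflexive (trans (cong (λ m → m ∸ 1 ∸ N) (+-suc N s)) (m+n∸m≡n N s)))
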